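{- Let $k\geq 1$ be an integer and define the $k$-bonacci numbers $f_n^{(k)}$ for all integers $n$ by $f_n^{(k)}=0$ for $n<0$, $f_0^{(k)}=1$, and $f_n^{(k)}=\sum_{i=1}^k f_{n-i}^{(k)}$ for $n\geq 1$. Then for every integer $n\geq 0$ and every integer $m$ with $\lfloor n/k\rfloor \geq m\geq \lfloor n/(k+1)\rfloor$, \[ \sum_{i=0}^{n} f_i^{(k)} = \sum_{j=0}^{m} (-1)^{j}\binom{n-jk}{j}2^{\,n-j(k+1)}. \]
   Context: $\lfloor x\rfloor$ denotes the largest integer less than or equal to $x$. The binomial coefficient $\binom{a}{b}$ for integers $a\geq 0$, $b\geq 0$ is $0$ when $b>a$. -}

module Defs where

open import Data.Nat using (ℕ; zero; suc; _∸_; _*_; _+_)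
open import Data.Nat.Combinatorics using (_C_)
open import Data.List using (List; []; _∷_; take; map; upTo)
open import Data.Nat.ListAction using (sum)
open import Data.Integer as ℤ using (ℤ; +_; -1ℤ)

mutual
  kbonacci : ℕ → ℕ → ℕ
  kbonacci k zero = 1
  -- f_{n+1} = f_n + ... + f_{n+1-k}; hist k n = [f_n, f_{n-1}, ..., f_0],
  -- and terms with negative index (missing from the list) are 0
  kbonacci k (suc n) = sum (take k (hist k n))

  hist : ℕ → ℕ → List ℕ
  hist k zero = 1 ∷ []
  hist k (suc n) = kbonacci k (suc n) ∷ hist k n

kbonacciPartialSum : ℕ → ℕ → ℕ
kbonacciPartialSum k n = sum (map (kbonacci k) (upTo (suc n)))

Σℤ : ℕ → (ℕ → ℤ) → ℤ
Σℤ m g = Data.List.foldr ℤ._+_ (+ 0) (map g (upTo (suc m)))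

-- the j-th summand (-1)^j * C(n - jk, j) * 2^(n - j(k+1)).
-- (natural subtraction; whenever j(k+1) > n one has n - jk < j, so C(n-jk, j) = 0
-- and the truncation in the exponent is irrelevant)
rhsTerm : ℕ → ℕ → ℕ → ℤ
rhsTerm k n j = (-1ℤ ℤ.^ j) ℤ.* (+ (((n ∸ j * k) C j) * (2 Data.Nat.^ (n ∸ j * (k + 1)))))

-- Write S n = f 0 + … + f n.  Since f (n + 1) = S n − S (n − k − 1), the partial sums satisfy
-- S (n + 1) = 2 S n − S (n − k − 1), with S equal to 0 at negative indices.  Writing the
-- right-hand side as T n = Σ_j (−1)^j C(n − jk, j) 2^(n − j(k+1)), Pascal's rule
-- C(a + j + 1, j + 1) = C(a + j, j + 1) + C(a + j, j) shows that T obeys the same recurrence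
-- and T 0 = 1, so S = T.  The summand vanishes as soon as j(k+1) > n, so the sum may be cut
-- anywhere at or beyond ⌊n/(k+1)⌋.
module Submission where

open import Defs
open import Data.Nat using (ℕ; NonZero; _≤_; _/_; suc)
open import Relation.Binary.PropositionalEquality using (_≡_)

module PartialSums where
  open import Data.Nat using (zero; _+_; _*_; _<_)
  open import Data.Nat.Properties using (+-identityʳ; +-assoc; +-comm)
  open import Data.Nat.ListAction using (sum)
  open import Data.Nat.ListAction.Properties using (sum-++)
  open import Data.List using ([_]; _++_; map; take; drop; length; upTo)
  open import Data.List.Properties using (applyUpTo-∷ʳ; map-++; take-all; take++drop≡id)
  open import Function using (id; _∘_)
  open import Relation.Binary.PropositionalEquality using (refl; sym; cong; subst; module ≡-Reasoning)
  open ≡-Reasoning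

  sum-map-upTo-suc : ∀ (g : ℕ → ℕ) n → sum (map g (upTo (suc n))) ≡ sum (map g (upTo n)) + g n
  sum-map-upTo-suc g n = begin
    sum (map g (upTo (suc n)))          ≡⟨ cong (sum ∘ map g) (applyUpTo-∷ʳ id n) ⟨
    sum (map g (upTo n ++ [ n ]))       ≡⟨ cong sum (map-++ g (upTo n) [ n ]) ⟩
    sum (map g (upTo n) ++ [ g n ])     ≡⟨ sum-++ (map g (upTo n)) [ g n ] ⟩
    sum (map g (upTo n)) + (g n + 0)    ≡⟨ cong (sum (map g (upTo n)) +_) (+-identityʳ (g n)) ⟩
    sum (map g (upTo n)) + g n          ∎

  kbonacciPartialSum≡sum-hist : ∀ k n → kbonacciPartialSum k n ≡ sum (hist k n)
  kbonacciPartialSum≡sum-hist k zero = refl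
  kbonacciPartialSum≡sum-hist k (suc n) = begin
    kbonacciPartialSum k (suc n)                 ≡⟨ sum-map-upTo-suc (kbonacci k) (suc n) ⟩
    kbonacciPartialSum k n + kbonacci k (suc n)  ≡⟨ cong (_+ kbonacci k (suc n)) (kbonacciPartialSum≡sum-hist k n) ⟩
    sum (hist k n) + kbonacci k (suc n)          ≡⟨ +-comm (sum (hist k n)) (kbonacci k (suc n)) ⟩
    sum (hist k (suc n))                         ∎

  length-hist : ∀ k n → length (hist k n) ≡ suc n
  length-hist k zero = refl
  length-hist k (suc n) = cong suc (length-hist k n)

  drop-hist : ∀ k j r → drop j (hist k (j + r)) ≡ hist k r
  drop-hist k zero r = refl
  drop-hist k (suc j) r = drop-hist k j r

  sum-hist≡kbonacci+sum-drop : ∀ k n → sum (hist k n) ≡ kbonacci k (suc n) + sum (drop k (hist k n))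
  sum-hist≡kbonacci+sum-drop k n = begin
    sum (hist k n)                                     ≡⟨ cong sum (take++drop≡id k (hist k n)) ⟨
    sum (take k (hist k n) ++ drop k (hist k n))       ≡⟨ sum-++ (take k (hist k n)) (drop k (hist k n)) ⟩
    kbonacci k (suc n) + sum (drop k (hist k n))       ∎

  sum-hist-doubling : ∀ k n → n < k → sum (hist k (suc n)) ≡ 2 * sum (hist k n)
  sum-hist-doubling k n n<k = begin
    kbonacci k (suc n) + sum (hist k n)  ≡⟨ cong (λ xs → sum xs + sum (hist k n)) (take-all k (hist k n) k≥length) ⟩
    sum (hist k n) + sum (hist k n)      ≡⟨ cong (sum (hist k n) +_) (+-identityʳ (sum (hist k n))) ⟨
    2 * sum (hist k n)                   ∎
    where
    k≥length : length (hist k n) ≤ k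
    k≥length = subst (_≤ k) (sym (length-hist k n)) n<k

  sum-hist-recurrence : ∀ k r →
    sum (hist k (suc (k + r))) + sum (hist k r) ≡ 2 * sum (hist k (k + r))
  sum-hist-recurrence k r = begin
    (f + S[k+r]) + sum (hist k r)  ≡⟨ +-assoc f S[k+r] (sum (hist k r)) ⟩
    f + (S[k+r] + sum (hist k r))  ≡⟨ cong (f +_) (+-comm S[k+r] (sum (hist k r))) ⟩
    f + (sum (hist k r) + S[k+r])  ≡⟨ +-assoc f (sum (hist k r)) S[k+r] ⟨
    (f + sum (hist k r)) + S[k+r]  ≡⟨ cong (_+ S[k+r]) split ⟨
    S[k+r] + S[k+r]                ≡⟨ cong (S[k+r] +_) (+-identityʳ S[k+r]) ⟨
    2 * S[k+r]                     ∎
    where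
    f = kbonacci k (suc (k + r))
    S[k+r] = sum (hist k (k + r))
    split : S[k+r] ≡ f + sum (hist k r)
    split = begin
      S[k+r]                              ≡⟨ sum-hist≡kbonacci+sum-drop k (k + r) ⟩
      f + sum (drop k (hist k (k + r)))   ≡⟨ cong (λ xs → f + sum xs) (drop-hist k k r) ⟩
      f + sum (hist k r)                  ∎

module Coefficient where
  open import Data.Nat using (zero; _+_; _*_; _∸_; _^_; _<_; _≤?_)
  open import Data.Nat.Properties
    using (+-suc; +-assoc; +-identityʳ; m+n∸m≡n; m<n+o⇒m∸n<o; +-monoʳ-<; <-trans; n<1+n; ≤-reflexive; ≰⇒>; m≤n⇒∃[o]m+o≡n)
  open import Data.Nat.Combinatorics using (_C_; k>n⇒nCk≡0; nCk+nC[k+1]≡[n+1]C[k+1]; nCn≡1)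
  open import Data.Nat.Tactic.RingSolver using (solve-∀)
  open import Data.Product using (_,_)
  open import Relation.Nullary using (yes; no)
  open import Relation.Binary.PropositionalEquality using (refl; trans; cong; cong₂; subst; module ≡-Reasoning)
  open ≡-Reasoning

  coeff : ℕ → ℕ → ℕ → ℕ
  coeff k n j = ((n ∸ j * k) C j) * (2 ^ (n ∸ j * (k + 1)))

  j[k+1]≡jk+j : ∀ j k → j * (k + 1) ≡ j * k + j
  j[k+1]≡jk+j = solve-∀

  j[k+1]+a≡jk+[a+j] : ∀ j k a → j * (k + 1) + a ≡ j * k + (a + j)
  j[k+1]+a≡jk+[a+j] = solve-∀

  coeff-vanishes : ∀ k n j → n < j * (k + 1) → coeff k n j ≡ 0
  coeff-vanishes k n zero ()
  coeff-vanishes k n j@(suc _) n<j[k+1] =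
    cong (_* (2 ^ (n ∸ j * (k + 1)))) (k>n⇒nCk≡0 (m<n+o⇒m∸n<o n (j * k) n<jk+j))
    where
    n<jk+j : n < j * k + j
    n<jk+j = subst (n <_) (j[k+1]≡jk+j j k) n<j[k+1]

  coeff-on-support : ∀ k j a {n} → n ≡ j * (k + 1) + a → coeff k n j ≡ ((a + j) C j) * 2 ^ a
  coeff-on-support k j a refl = cong₂ (λ x y → (x C j) * 2 ^ y) top (m+n∸m≡n (j * (k + 1)) a)
    where
    top : j * (k + 1) + a ∸ j * k ≡ a + j
    top = trans (cong (_∸ j * k) (j[k+1]+a≡jk+[a+j] j k a)) (m+n∸m≡n (j * k) (a + j))

  1+k+[i[k+1]+a]≡[1+i][k+1]+a : ∀ k i a → suc (k + (i * (k + 1) + a)) ≡ suc i * (k + 1) + a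
  1+k+[i[k+1]+a]≡[1+i][k+1]+a = solve-∀

  k+[i[k+1]+1+a]≡[1+i][k+1]+a : ∀ k i a → k + (i * (k + 1) + suc a) ≡ suc i * (k + 1) + a
  k+[i[k+1]+1+a]≡[1+i][k+1]+a = solve-∀

  coeff-pascal-on-support : ∀ k i a → let r = i * (k + 1) + a in
    coeff k (suc (k + r)) (suc i) ≡ 2 * coeff k (k + r) (suc i) + coeff k r i
  coeff-pascal-on-support k i zero = begin
    coeff k (suc (k + r)) (suc i)              ≡⟨ coeff-on-support k (suc i) 0 (1+k+[i[k+1]+a]≡[1+i][k+1]+a k i 0) ⟩
    (suc i C suc i) * 1                        ≡⟨ cong (_* 1) (nCn≡1 (suc i)) ⟩
    1                                          ≡⟨ cong (_* 1) (nCn≡1 i) ⟨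
    (i C i) * 1                                ≡⟨ coeff-on-support k i 0 refl ⟨
    coeff k r i                                ≡⟨ cong (λ x → 2 * x + coeff k r i) below-support ⟨
    2 * coeff k (k + r) (suc i) + coeff k r i  ∎
    where
    r = i * (k + 1) + 0
    below-support : coeff k (k + r) (suc i) ≡ 0
    below-support = coeff-vanishes k (k + r) (suc i) (≤-reflexive (trans (1+k+[i[k+1]+a]≡[1+i][k+1]+a k i 0) (+-identityʳ (suc i * (k + 1)))))
  coeff-pascal-on-support k i (suc b) = begin
    coeff k (suc (k + r)) (suc i)
      ≡⟨ coeff-on-support k (suc i) (suc b) (1+k+[i[k+1]+a]≡[1+i][k+1]+a k i (suc b)) ⟩
    (suc (b + suc i) C suc i) * (2 * p)
      ≡⟨ cong (_* (2 * p)) (nCk+nC[k+1]≡[n+1]C[k+1] (b + suc i) i) ⟨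
    ((b + suc i) C i + (b + suc i) C suc i) * (2 * p)
      ≡⟨ distrib ((b + suc i) C i) ((b + suc i) C suc i) p ⟩
    2 * (((b + suc i) C suc i) * p) + ((b + suc i) C i) * (2 * p)
      ≡⟨ cong (λ x → 2 * (((b + suc i) C suc i) * p) + (x C i) * (2 * p)) (+-suc b i) ⟩
    2 * (((b + suc i) C suc i) * p) + ((suc b + i) C i) * (2 * p)
      ≡⟨ cong₂ (λ x y → 2 * x + y) (coeff-on-support k (suc i) b (k+[i[k+1]+1+a]≡[1+i][k+1]+a k i b))
                                    (coeff-on-support k i (suc b) refl) ⟨
    2 * coeff k (k + r) (suc i) + coeff k r i
      ∎
    where
    r = i * (k + 1) + suc b
    p = 2 ^ b
    distrib : ∀ z y p → (z + y) * (2 * p) ≡ 2 * (y * p) + z * (2 * p)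
    distrib = solve-∀

  coeff-pascal : ∀ k r i → coeff k (suc (k + r)) (suc i) ≡ 2 * coeff k (k + r) (suc i) + coeff k r i
  coeff-pascal k r i with i * (k + 1) ≤? r
  ... | yes i[k+1]≤r with (a , refl) ← m≤n⇒∃[o]m+o≡n i[k+1]≤r = coeff-pascal-on-support k i a
  ... | no i[k+1]≰r = begin
    coeff k (suc (k + r)) (suc i)              ≡⟨ coeff-vanishes k (suc (k + r)) (suc i) 1+k+r<bound ⟩
    0                                          ≡⟨ cong₂ (λ x y → 2 * x + y)
                                                   (coeff-vanishes k (k + r) (suc i) (<-trans (n<1+n (k + r)) 1+k+r<bound))
                                                   (coeff-vanishes k r i r<i[k+1]) ⟨
    2 * coeff k (k + r) (suc i) + coeff k r i  ∎
    where
    r<i[k+1] : r < i * (k + 1)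
    r<i[k+1] = ≰⇒> i[k+1]≰r
    1+k+r<bound : suc (k + r) < suc i * (k + 1)
    1+k+r<bound = subst (_< suc i * (k + 1)) (trans (+-assoc k 1 r) (+-suc k r)) (+-monoʳ-< (k + 1) r<i[k+1])

module FiniteSums where
  open import Data.Nat using (zero; _<_; s≤s; z≤n)
  open import Data.Nat.Properties using (m≤n⇒m<n∨m≡n)
  open import Data.Integer using (ℤ; 0ℤ; _+_; _*_; _-_)
  open import Data.Integer.Properties using (+-identityʳ; +-identityˡ; +-assoc)
  open import Data.Integer.Tactic.RingSolver using (solve-∀)
  open import Data.List using (foldr; map; applyUpTo)
  open import Data.Sum using (inj₁; inj₂)
  open import Function using (id; _∘_)
  open import Relation.Binary.PropositionalEquality using (refl; sym; trans; cong; cong₂; module ≡-Reasoning)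
  open ≡-Reasoning

  sum≤ : ℕ → (ℕ → ℤ) → ℤ
  sum≤ zero g = g 0
  sum≤ (suc m) g = g 0 + sum≤ m (g ∘ suc)

  foldr-map-applyUpTo≡sum≤ : ∀ m (g : ℕ → ℤ) (f : ℕ → ℕ) →
    foldr _+_ 0ℤ (map g (applyUpTo f (suc m))) ≡ sum≤ m (g ∘ f)
  foldr-map-applyUpTo≡sum≤ zero g f = +-identityʳ (g (f 0))
  foldr-map-applyUpTo≡sum≤ (suc m) g f = cong (g (f 0) +_) (foldr-map-applyUpTo≡sum≤ m g (f ∘ suc))

  Σℤ≡sum≤ : ∀ m g → Σℤ m g ≡ sum≤ m g
  Σℤ≡sum≤ m g = foldr-map-applyUpTo≡sum≤ m g id

  sum≤-cong : ∀ m {g h : ℕ → ℤ} → (∀ j → g j ≡ h j) → sum≤ m g ≡ sum≤ m h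
  sum≤-cong zero g≗h = g≗h 0
  sum≤-cong (suc m) g≗h = cong₂ _+_ (g≗h 0) (sum≤-cong m (g≗h ∘ suc))

  sum≤-suc : ∀ m g → sum≤ (suc m) g ≡ sum≤ m g + g (suc m)
  sum≤-suc zero g = refl
  sum≤-suc (suc m) g = trans (cong (g 0 +_) (sum≤-suc m (g ∘ suc))) (sym (+-assoc (g 0) _ _))

  sum≤-zero : ∀ m → sum≤ m (λ _ → 0ℤ) ≡ 0ℤ
  sum≤-zero zero = refl
  sum≤-zero (suc m) = trans (+-identityˡ _) (sum≤-zero m)

  sum≤-linear : ∀ m a g h → sum≤ m (λ j → a * g j - h j) ≡ a * sum≤ m g - sum≤ m h
  sum≤-linear zero a g h = refl
  sum≤-linear (suc m) a g h = begin
    (a * g 0 - h 0) + sum≤ m (λ j → a * g (suc j) - h (suc j))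
      ≡⟨ cong ((a * g 0 - h 0) +_) (sum≤-linear m a (g ∘ suc) (h ∘ suc)) ⟩
    (a * g 0 - h 0) + (a * sum≤ m (g ∘ suc) - sum≤ m (h ∘ suc))
      ≡⟨ regroup a (g 0) (sum≤ m (g ∘ suc)) (h 0) (sum≤ m (h ∘ suc)) ⟩
    a * (g 0 + sum≤ m (g ∘ suc)) - (h 0 + sum≤ m (h ∘ suc))
      ∎
    where
    regroup : ∀ a x y u v → (a * x - u) + (a * y - v) ≡ a * (x + y) - (u + v)
    regroup = solve-∀

  sum≤-truncate : ∀ {b} m g → b ≤ m → (∀ j → b < j → g j ≡ 0ℤ) → sum≤ m g ≡ sum≤ b g
  sum≤-truncate zero g z≤n _ = refl
  sum≤-truncate {b} (suc m) g b≤1+m g-vanishes with m≤n⇒m<n∨m≡n b≤1+m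
  ... | inj₂ refl = refl
  ... | inj₁ (s≤s b≤m) = begin
    sum≤ (suc m) g          ≡⟨ sum≤-suc m g ⟩
    sum≤ m g + g (suc m)    ≡⟨ cong₂ _+_ (sum≤-truncate m g b≤m g-vanishes) (g-vanishes (suc m) (s≤s b≤m)) ⟩
    sum≤ b g + 0ℤ           ≡⟨ +-identityʳ (sum≤ b g) ⟩
    sum≤ b g                ∎

module AlternatingSum where
  open PartialSums
  open Coefficient
  open FiniteSums
  import Data.Nat as ℕ
  open import Data.Nat using (zero; _<_; s≤s; z≤n)
  open import Data.Nat.Properties using (≤-trans; ≰⇒>; <⇒≱; n≤1+n; n<1+n; m≤n+m; m≤n⇒∃[o]m+o≡n)
    renaming (+-comm to ℕ-+-comm; *-identityˡ to ℕ-*-identityˡ)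
  open import Data.Nat.DivMod using (m/n≤m; m*n/n≡m; /-monoˡ-≤; m<n⇒m/n≡0)
  open import Data.Nat.Induction using (<-rec)
  open import Data.Nat.ListAction using (sum)
  open import Data.Integer using (ℤ; +_; 0ℤ; -1ℤ; _+_; _*_; _-_; _^_)
  open import Data.Integer.Properties using (*-zeroʳ; *-identityˡ; +-identityʳ; pos-+; pos-*)
  open import Data.Integer.Tactic.RingSolver using (solve-∀)
  open import Data.Product using (_,_)
  open import Relation.Nullary using (¬_; yes; no)
  open import Relation.Binary.PropositionalEquality using (refl; sym; trans; cong; cong₂; subst; module ≡-Reasoning)
  open ≡-Reasoning

  rhsSum : ℕ → ℕ → ℤ
  rhsSum k n = sum≤ n (rhsTerm k n)

  rhsTerm-vanishes : ∀ k n j → n ℕ.< j ℕ.* (k ℕ.+ 1) → rhsTerm k n j ≡ 0ℤ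
  rhsTerm-vanishes k n j n<j[k+1] =
    trans (cong (λ c → (-1ℤ ^ j) * + c) (coeff-vanishes k n j n<j[k+1])) (*-zeroʳ (-1ℤ ^ j))

  rhsTerm-beyond : ∀ k n j → n / suc k < j → rhsTerm k n j ≡ 0ℤ
  rhsTerm-beyond k n j n/[1+k]<j = rhsTerm-vanishes k n j (≰⇒> j[k+1]≰n)
    where
    j[k+1]≰n : ¬ (j ℕ.* (k ℕ.+ 1) ≤ n)
    j[k+1]≰n j[k+1]≤n = <⇒≱ n/[1+k]<j (subst (_≤ n / suc k) j[k+1]/[1+k]≡j (/-monoˡ-≤ (suc k) j[k+1]≤n))
      where
      j[k+1]/[1+k]≡j : j ℕ.* (k ℕ.+ 1) / suc k ≡ j
      j[k+1]/[1+k]≡j = trans (cong (λ d → j ℕ.* d / suc k) (ℕ-+-comm k 1)) (m*n/n≡m j (suc k))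

  rhsTerm-below-k : ∀ k n i → n ≤ k → rhsTerm k n (suc i) ≡ 0ℤ
  rhsTerm-below-k k n i n≤k = rhsTerm-beyond k n (suc i) (subst (_< suc i) (sym (m<n⇒m/n≡0 (s≤s n≤k))) (s≤s z≤n))

  rhsTerm-zero : ∀ k n → rhsTerm k n 0 ≡ + 2 ℕ.^ n
  rhsTerm-zero k n = trans (*-identityˡ _) (cong +_ (ℕ-*-identityˡ (2 ℕ.^ n)))

  rhsTerm-pascal : ∀ k r i →
    rhsTerm k (suc (k ℕ.+ r)) (suc i) ≡ + 2 * rhsTerm k (k ℕ.+ r) (suc i) - rhsTerm k r i
  rhsTerm-pascal k r i = begin
    σ * + coeff k (suc (k ℕ.+ r)) (suc i)       ≡⟨ cong (λ c → σ * + c) (coeff-pascal k r i) ⟩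
    σ * + (2 ℕ.* c₁ ℕ.+ c₂)                      ≡⟨ cong (σ *_) (trans (pos-+ (2 ℕ.* c₁) c₂) (cong (_+ + c₂) (pos-* 2 c₁))) ⟩
    σ * (+ 2 * + c₁ + + c₂)                      ≡⟨ flip-sign (-1ℤ ^ i) (+ c₁) (+ c₂) ⟩
    + 2 * (σ * + c₁) - (-1ℤ ^ i) * + c₂          ∎
    where
    σ = -1ℤ ^ suc i
    c₁ = coeff k (k ℕ.+ r) (suc i)
    c₂ = coeff k r i
    flip-sign : ∀ s x y → (-1ℤ * s) * (+ 2 * x + y) ≡ + 2 * ((-1ℤ * s) * x) - s * y
    flip-sign = solve-∀

  sum≤-rhsTerm-cutoff : ∀ k {n m m′} → n / suc k ≤ m → n / suc k ≤ m′ →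
    sum≤ m (rhsTerm k n) ≡ sum≤ m′ (rhsTerm k n)
  sum≤-rhsTerm-cutoff k {n} {m} {m′} b≤m b≤m′ =
    trans (sum≤-truncate m (rhsTerm k n) b≤m (rhsTerm-beyond k n))
          (sym (sum≤-truncate m′ (rhsTerm k n) b≤m′ (rhsTerm-beyond k n)))

  rhsSum-extend : ∀ k {n m} → n ≤ m → sum≤ m (rhsTerm k n) ≡ rhsSum k n
  rhsSum-extend k {n} n≤m = sum≤-rhsTerm-cutoff k (≤-trans (m/n≤m n (suc k)) n≤m) (m/n≤m n (suc k))

  rhsSum-suc : ∀ k n h → (∀ i → rhsTerm k (suc n) (suc i) ≡ + 2 * rhsTerm k n (suc i) - h i) →
    rhsSum k (suc n) ≡ + 2 * rhsSum k n - sum≤ n h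
  rhsSum-suc k n h step = begin
    rhsTerm k (suc n) 0 + sum≤ n (λ i → rhsTerm k (suc n) (suc i))
      ≡⟨ cong₂ _+_ (rhsTerm-zero k (suc n)) (sum≤-cong n step) ⟩
    + 2 ℕ.^ suc n + sum≤ n (λ i → + 2 * rhsTerm k n (suc i) - h i)
      ≡⟨ cong₂ _+_ (pos-* 2 (2 ℕ.^ n)) (sum≤-linear n (+ 2) (λ i → rhsTerm k n (suc i)) h) ⟩
    + 2 * + 2 ℕ.^ n + (+ 2 * sum≤ n (λ i → rhsTerm k n (suc i)) - sum≤ n h)
      ≡⟨ regroup (+ 2 ℕ.^ n) (sum≤ n (λ i → rhsTerm k n (suc i))) (sum≤ n h) ⟩
    + 2 * (+ 2 ℕ.^ n + sum≤ n (λ i → rhsTerm k n (suc i))) - sum≤ n h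
      ≡⟨ cong (λ x → + 2 * (x + sum≤ n (λ i → rhsTerm k n (suc i))) - sum≤ n h) (rhsTerm-zero k n) ⟨
    + 2 * sum≤ (suc n) (rhsTerm k n) - sum≤ n h
      ≡⟨ cong (λ x → + 2 * x - sum≤ n h) (rhsSum-extend k (n≤1+n n)) ⟩
    + 2 * rhsSum k n - sum≤ n h
      ∎
    where
    regroup : ∀ x y z → + 2 * x + (+ 2 * y - z) ≡ + 2 * (x + y) - z
    regroup = solve-∀

  rhsSum-recurrence : ∀ k r → rhsSum k (suc (k ℕ.+ r)) ≡ + 2 * rhsSum k (k ℕ.+ r) - rhsSum k r
  rhsSum-recurrence k r =
    trans (rhsSum-suc k (k ℕ.+ r) (rhsTerm k r) (rhsTerm-pascal k r))
          (cong (+ 2 * rhsSum k (k ℕ.+ r) -_) (rhsSum-extend k (m≤n+m r k)))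

  rhsSum-doubling : ∀ k n → n < k → rhsSum k (suc n) ≡ + 2 * rhsSum k n
  rhsSum-doubling k n n<k = begin
    rhsSum k (suc n)                       ≡⟨ rhsSum-suc k n (λ _ → 0ℤ) both-vanish ⟩
    + 2 * rhsSum k n - sum≤ n (λ _ → 0ℤ)   ≡⟨ cong (+ 2 * rhsSum k n -_) (sum≤-zero n) ⟩
    + 2 * rhsSum k n - 0ℤ                  ≡⟨ +-identityʳ (+ 2 * rhsSum k n) ⟩
    + 2 * rhsSum k n                       ∎
    where
    both-vanish : ∀ i → rhsTerm k (suc n) (suc i) ≡ + 2 * rhsTerm k n (suc i) - 0ℤ
    both-vanish i = trans (rhsTerm-below-k k (suc n) i n<k)
                          (sym (cong (λ x → + 2 * x - 0ℤ) (rhsTerm-below-k k n i (≤-trans (n≤1+n n) n<k))))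

  pos-recurrence : ∀ a b c → a ℕ.+ b ≡ 2 ℕ.* c → + a ≡ + 2 * + c - + b
  pos-recurrence a b c a+b≡2c = begin
    + a                  ≡⟨ cancel (+ a) (+ b) ⟩
    (+ a + + b) - + b    ≡⟨ cong (_- + b) (trans (sym (pos-+ a b)) (trans (cong +_ a+b≡2c) (pos-* 2 c))) ⟩
    + 2 * + c - + b      ∎
    where
    cancel : ∀ x y → x ≡ (x + y) - y
    cancel = solve-∀

  sum-hist≡rhsSum : ∀ k n → + sum (hist k n) ≡ rhsSum k n
  sum-hist≡rhsSum k = <-rec (λ n → + sum (hist k n) ≡ rhsSum k n) step
    where
    step : ∀ n → (∀ {m} → m < n → + sum (hist k m) ≡ rhsSum k m) → + sum (hist k n) ≡ rhsSum k n
    step zero _ = refl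
    step (suc n) ih with k ℕ.≤? n
    ... | no k≰n = begin
      + sum (hist k (suc n))     ≡⟨ cong +_ (sum-hist-doubling k n (≰⇒> k≰n)) ⟩
      + (2 ℕ.* sum (hist k n))   ≡⟨ pos-* 2 (sum (hist k n)) ⟩
      + 2 * + sum (hist k n)     ≡⟨ cong (+ 2 *_) (ih (n<1+n n)) ⟩
      + 2 * rhsSum k n           ≡⟨ rhsSum-doubling k n (≰⇒> k≰n) ⟨
      rhsSum k (suc n)           ∎
    ... | yes k≤n with (r , refl) ← m≤n⇒∃[o]m+o≡n k≤n = begin
      + sum (hist k (suc (k ℕ.+ r)))
        ≡⟨ pos-recurrence (sum (hist k (suc (k ℕ.+ r)))) (sum (hist k r)) (sum (hist k (k ℕ.+ r)))
                          (sum-hist-recurrence k r) ⟩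
      + 2 * + sum (hist k (k ℕ.+ r)) - + sum (hist k r)
        ≡⟨ cong₂ (λ x y → + 2 * x - y) (ih (n<1+n (k ℕ.+ r))) (ih (s≤s (m≤n+m r k))) ⟩
      + 2 * rhsSum k (k ℕ.+ r) - rhsSum k r
        ≡⟨ rhsSum-recurrence k r ⟨
      rhsSum k (suc (k ℕ.+ r))
        ∎

open PartialSums using (kbonacciPartialSum≡sum-hist)
open FiniteSums using (sum≤; Σℤ≡sum≤)
open AlternatingSum using (sum-hist≡rhsSum; sum≤-rhsTerm-cutoff)
open import Data.Integer using (+_)
open import Data.Nat.DivMod using (m/n≤m)
open import Data.Nat.ListAction using (sum)
open import Relation.Binary.PropositionalEquality using (cong; module ≡-Reasoning)
open ≡-Reasoning

mainTheorem2 : (k : ℕ) → .{{_ : NonZero k}} → (n m : ℕ) →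
    n / suc k ≤ m → m ≤ n / k →
    + kbonacciPartialSum k n ≡ Σℤ m (rhsTerm k n)
mainTheorem2 k n m n/[1+k]≤m _ = begin
  + kbonacciPartialSum k n   ≡⟨ cong +_ (kbonacciPartialSum≡sum-hist k n) ⟩
  + sum (hist k n)           ≡⟨ sum-hist≡rhsSum k n ⟩
  sum≤ n (rhsTerm k n)       ≡⟨ sum≤-rhsTerm-cutoff k (m/n≤m n (suc k)) n/[1+k]≤m ⟩
  sum≤ m (rhsTerm k n)       ≡⟨ Σℤ≡sum≤ m (rhsTerm k n) ⟨
  Σℤ m (rhsTerm k n)         ∎
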